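{- Let $G$ be a weighted graph and $k$ a positive integer. A maximum $k$-matching in the reduced subgraph $G_R$ of $G$ is also a maximum $k$-matching in $G$.
   Context: $G$ is an undirected weighted graph with real edge weights $wt(e)$; vertices carry distinct, totally ordered labels. A $k$-matching is a set of exactly $k$ edges no two sharing an endpoint; its weight is $\sum wt(e)$, and a maximum $k$-matching has maximum weight among all $k$-matchings. Define $wt'(e) = (wt(e), \min\{v,w\}, \max\{v,w\})$ for $e=[v,w]$, compared lexicographically; "heaviest" refers to $wt'$. The trimmed subgraph $G_T$ consists of all edges $e=[v,w]$ of $G$ that are among the $8k$ heaviest edges incident to $v$ and among the $8k$ heaviest edges incident to $w$ (all edges count for a vertex of degree less than $8k$), with their endpoints. The reduced subgraph $G_R$ is $G_T$ itself if $G_T$ has at most $k(16k-1)$ edges, and otherwise consists of the $k(16k-1)$ heaviest edges of $G_T$ together with their endpoints.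
   Formalization: The edge weights $wt(e)$ are rational instead of real. -}

module Defs where

open import Data.Nat as ℕ using (ℕ; _*_; _∸_)
open import Data.Fin as Fin using (Fin)
import Data.Fin.Properties as FinP
open import Data.Rational as ℚ using (ℚ; 0ℚ)
import Data.Rational.Properties as ℚP
open import Data.Product using (_×_; _,_; proj₁; proj₂)
open import Data.Sum using (_⊎_)
open import Data.List using (List; length; filter; map; foldr)
open import Data.List.Relation.Unary.All using (All)
open import Data.List.Relation.Unary.AllPairs using (AllPairs)
open import Data.List.Relation.Unary.Unique.Propositional using (Unique)
open import Data.List.Membership.Propositional using (_∈_)
open import Data.Bool using (if_then_else_)
open import Relation.Nullary using (¬_; Dec; does)
open import Relation.Nullary.Decidable using (_⊎-dec_; _×-dec_)
open import Relation.Binary.PropositionalEquality using (_≡_; _≢_)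

-- An edge on vertex set Fin n, stored as (min endpoint, max endpoint).
Edge : ℕ → Set
Edge n = Fin n × Fin n

record WGraph (n : ℕ) : Set where
  field
    edges   : List (Edge n)
    ordered : All (λ e → proj₁ e Fin.< proj₂ e) edges   -- no loops, canonical orientation
    unique  : Unique edges
    wt      : Edge n → ℚ
open WGraph public

module _ {n : ℕ} (G : WGraph n) where

  -- e ≺ f : f is heavier than e w.r.t. wt'(e) = (wt e, min, max), lexicographically
  _≺_ : Edge n → Edge n → Set
  e ≺ f = wt G e ℚ.< wt G f
        ⊎ (wt G e ≡ wt G f × (proj₁ e Fin.< proj₁ f
                              ⊎ (proj₁ e ≡ proj₁ f × proj₂ e Fin.< proj₂ f)))

  _≺?_ : (e f : Edge n) → Dec (e ≺ f)
  e ≺? f = (wt G e ℚP.<? wt G f)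
         ⊎-dec ((wt G e ℚP.≟ wt G f) ×-dec ((proj₁ e FinP.<? proj₁ f)
                  ⊎-dec ((proj₁ e FinP.≟ proj₁ f) ×-dec (proj₂ e FinP.<? proj₂ f))))

  Incident : Fin n → Edge n → Set
  Incident v e = proj₁ e ≡ v ⊎ proj₂ e ≡ v

  incident? : (v : Fin n) (e : Edge n) → Dec (Incident v e)
  incident? v e = (proj₁ e FinP.≟ v) ⊎-dec (proj₂ e FinP.≟ v)

  rankAt : Fin n → Edge n → ℕ
  rankAt v e = length (filter (λ f → incident? v f ×-dec (e ≺? f)) (edges G))

  InTrimmed : ℕ → Edge n → Set
  InTrimmed k e = rankAt (proj₁ e) e ℕ.< 8 * k × rankAt (proj₂ e) e ℕ.< 8 * k

  trimmedEdges : ℕ → List (Edge n)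
  trimmedEdges k =
    filter (λ e → (rankAt (proj₁ e) e ℕ.<? 8 * k) ×-dec (rankAt (proj₂ e) e ℕ.<? 8 * k))
           (edges G)

  rankIn : List (Edge n) → Edge n → ℕ
  rankIn L e = length (filter (λ f → e ≺? f) L)

  reducedEdges : ℕ → List (Edge n)
  reducedEdges k =
    if does (length (trimmedEdges k) ℕ.≤? k * (16 * k ∸ 1))
    then trimmedEdges k
    else filter (λ e → rankIn (trimmedEdges k) e ℕ.<? k * (16 * k ∸ 1)) (trimmedEdges k)

  Disjoint : Edge n → Edge n → Set
  Disjoint e f = proj₁ e ≢ proj₁ f × proj₁ e ≢ proj₂ f
               × proj₂ e ≢ proj₁ f × proj₂ e ≢ proj₂ f

  IsKMatching : List (Edge n) → ℕ → List (Edge n) → Set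
  IsKMatching L k M = All (_∈ L) M × length M ≡ k × AllPairs Disjoint M

  weight : List (Edge n) → ℚ
  weight M = foldr ℚ._+_ 0ℚ (map (wt G) M)

  IsMaxKMatching : List (Edge n) → ℕ → List (Edge n) → Set
  IsMaxKMatching L k M =
    IsKMatching L k M × (∀ M′ → IsKMatching L k M′ → weight M′ ℚ.≤ weight M)

-- Let M be a k-matching of G with an edge e outside G_R, and call the 2(k − 1) endpoints of the
-- other edges blocked.  If e is not in G_T, some endpoint v of e has at least 8k heavier incident
-- edges, and a blocked vertex u lies on at most two of them (uv and vu).  If e is in G_T but not
-- in G_R, at least k(16k − 1) edges of G_T are heavier than e, while every vertex has degree at
-- most 8k in G_T, because distinct edges at a vertex have distinct ranks there.  Either way some
-- heavier edge f avoids every blocked vertex, and exchanging e for f gives a k-matching of G that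
-- is at least as heavy and whose total rank (the number of heavier edges of G, summed over its
-- edges) is strictly smaller.  Iterating ends in a k-matching of G_R at least as heavy as M, so a
-- maximum k-matching of G_R is also maximum in G.
module Submission where

open import Defs
open import Data.Nat using (ℕ; suc; _+_; _*_; _∸_; _≤_; _<_; z≤n; s≤s; z<s; _<?_)
import Data.Nat.Properties as ℕP
open import Data.Nat.Induction using (<-wellFounded)
open import Data.Nat.ListAction using (sum)
open import Data.Nat.ListAction.Properties using (sum-↭)
open import Data.Nat.Tactic.RingSolver using (solve-∀)
open import Data.Fin as Fin using (Fin)
import Data.Fin.Properties as FinP
open import Data.Rational as ℚ using (ℚ)
import Data.Rational.Properties as ℚP
open import Data.Bool using (true; false; if_then_else_)
open import Data.Empty using (⊥-elim)
open import Data.Sum using (_⊎_; inj₁; inj₂)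
open import Data.Product using (_×_; _,_; proj₁; proj₂; map₂; ∃-syntax)
open import Data.Product.Properties using (×-≡,≡→≡; ≡-dec)
open import Data.Product.Relation.Binary.Pointwise.NonDependent using (Pointwise)
open import Data.Product.Relation.Binary.Lex.Strict
  using (×-Lex; ×-transitive; ×-irreflexive; ×-compare)
open import Data.List using (List; []; _∷_; _++_; length; filter; map; upTo)
open import Data.List.Properties using (length-map; length-upTo)
open import Data.List.Membership.Propositional using (_∈_; _∉_; find)
open import Data.List.Membership.Propositional.Properties
  using (∈-∃++; ∈-filter⁻; ∈-filter⁺; ∈-map⁻; ∈-upTo⁺)
open import Data.List.Relation.Unary.Any using (here; there)
open import Data.List.Relation.Unary.All as All using (All; []; _∷_; all?)
import Data.List.Relation.Unary.All.Properties as All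
open import Data.List.Relation.Unary.AllPairs using ([]; _∷_)
open import Data.List.Relation.Unary.Unique.Propositional using (Unique)
import Data.List.Relation.Unary.Unique.Propositional.Properties as Unique
open import Data.List.Relation.Binary.Subset.Propositional using (_⊆_)
import Data.List.Relation.Binary.Sublist.Propositional.Properties as Sublist
open import Data.List.Relation.Binary.Permutation.Propositional using (_↭_; ↭⇒↭ₛ)
open import Data.List.Relation.Binary.Permutation.Propositional.Properties
  using (shift; ∈-resp-↭; ↭-length; All-resp-↭)
import Data.List.Relation.Binary.Permutation.Propositional.Properties as ↭
open import Data.List.Relation.Binary.Permutation.Setoid.Properties
  using (AllPairs-resp-↭; foldr-commMonoid)
open import Function using (id; _∘_)
open import Induction.WellFounded using (Acc; acc)
open import Level using (Level; 0ℓ)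
open import Relation.Nullary using (¬_; yes; no; does)
open import Relation.Nullary.Decidable using (_×-dec_)
open import Relation.Unary using (Pred; Decidable; _∪_)
open import Relation.Unary.Properties using (∁?; _∪?_)
open import Relation.Binary.Definitions using (DecidableEquality; tri<; tri≈; tri>)
open import Relation.Binary.PropositionalEquality
  using (_≡_; _≢_; refl; sym; trans; subst; ≢-sym; setoid; isEquivalence; resp₂)

private
  variable
    a b p q r : Level
    A B : Set a

∈⇒↭∷ : {x : A} {xs : List A} → x ∈ xs → ∃[ ys ] xs ↭ x ∷ ys
∈⇒↭∷ {x = x} x∈xs with ys , zs , refl ← ∈-∃++ x∈xs = ys ++ zs , shift x ys zs

Unique⇒length≤ : {xs ys : List A} → Unique xs → xs ⊆ ys → length xs ≤ length ys
Unique⇒length≤ {xs = []} _ _ = z≤n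
Unique⇒length≤ {xs = x ∷ xs} {ys} (x∉xs ∷ xs!) x∷xs⊆ys
  with ys′ , ys↭x∷ys′ ← ∈⇒↭∷ (x∷xs⊆ys (here refl)) =
  ℕP.≤-trans (s≤s (Unique⇒length≤ xs! xs⊆ys′)) (ℕP.≤-reflexive (sym (↭-length ys↭x∷ys′)))
  where
    xs⊆ys′ : xs ⊆ ys′
    xs⊆ys′ y∈xs with ∈-resp-↭ ys↭x∷ys′ (x∷xs⊆ys (there y∈xs))
    ... | here y≡x     = ⊥-elim (All.lookup x∉xs y∈xs (sym y≡x))
    ... | there y∈ys′  = y∈ys′

length≤-injectiveOn : {P : Pred A p} (f : A → ℕ) → (∀ {x y} → P x → P y → f x ≡ f y → x ≡ y)
                    → ∀ {c xs} → Unique xs → All P xs → All (λ x → f x < c) xs → length xs ≤ c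
length≤-injectiveOn {P = P} f injective {c} {xs} xs! Pxs f<c = begin
  length xs         ≡⟨ length-map f xs ⟨
  length (map f xs) ≤⟨ Unique⇒length≤ (map-unique xs! Pxs) fxs⊆upTo ⟩
  length (upTo c)   ≡⟨ length-upTo c ⟩
  c                 ∎
  where
    open ℕP.≤-Reasoning

    map-unique : ∀ {xs} → Unique xs → All P xs → Unique (map f xs)
    map-unique [] [] = []
    map-unique (x∉xs ∷ xs!) (Px ∷ Pxs) =
      All.map⁺ (All.zipWith (λ (x≢y , Py) fx≡fy → x≢y (injective Px Py fx≡fy)) (x∉xs , Pxs))
      ∷ map-unique xs! Pxs

    fxs⊆upTo : map f xs ⊆ upTo c
    fxs⊆upTo fx∈ with x , x∈xs , refl ← ∈-map⁻ f fx∈ = ∈-upTo⁺ (All.lookup f<c x∈xs)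

module _ {P : Pred A p} (P? : Decidable P) where

  length≤filter+filter∁ : ∀ xs → length xs ≤ length (filter P? xs) + length (filter (∁? P?) xs)
  length≤filter+filter∁ [] = z≤n
  length≤filter+filter∁ (x ∷ xs) with ih ← length≤filter+filter∁ xs | does (P? x)
  ... | true  = s≤s ih
  ... | false = ℕP.≤-trans (s≤s ih) (ℕP.≤-reflexive (sym (ℕP.+-suc _ _)))

  if-filter-⊆ : ∀ b {xs} → (if b then xs else filter P? xs) ⊆ xs
  if-filter-⊆ true  = id
  if-filter-⊆ false = proj₁ ∘ ∈-filter⁻ P?

  ∉-if-filter⇒¬ : ∀ b {xs x} → x ∈ xs → x ∉ (if b then xs else filter P? xs) → ¬ P x
  ∉-if-filter⇒¬ true  x∈xs x∉ _  = x∉ x∈xs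
  ∉-if-filter⇒¬ false x∈xs x∉ Px = x∉ (∈-filter⁺ P? x∈xs Px)

module _ {P : Pred A p} {Q : Pred A q} (P? : Decidable P) (Q? : Decidable Q) where

  length-filter-∪ : ∀ xs
                  → length (filter (P? ∪? Q?) xs) ≤ length (filter P? xs) + length (filter Q? xs)
  length-filter-∪ [] = z≤n
  length-filter-∪ (x ∷ xs) with ih ← length-filter-∪ xs | does (P? x) | does (Q? x)
  ... | true  | true  = s≤s (ℕP.≤-trans ih (ℕP.+-monoʳ-≤ _ (ℕP.n≤1+n _)))
  ... | true  | false = s≤s ih
  ... | false | true  = ℕP.≤-trans (s≤s ih) (ℕP.≤-reflexive (sym (ℕP.+-suc _ _)))
  ... | false | false = ih

  length-filter-filter≤ : ∀ xs → length (filter P? (filter Q? xs)) ≤ length (filter P? xs)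
  length-filter-filter≤ xs =
    Sublist.length-mono-≤ (Sublist.filter⁺ P? P? (λ { refl → id }) (Sublist.filter-⊆ Q? xs))

  length-filter-< : (∀ {x} → P x → Q x) → ∀ {xs y} → Unique xs → y ∈ xs → Q y → ¬ P y
                  → length (filter P? xs) < length (filter Q? xs)
  length-filter-< P⇒Q {xs} {y} xs! y∈xs Qy ¬Py =
    Unique⇒length≤ (y∉ ∷ Unique.filter⁺ P? xs!) y∷⊆
    where
      y∉ : All (y ≢_) (filter P? xs)
      y∉ = All.tabulate λ { z∈ refl → ¬Py (proj₂ (∈-filter⁻ P? {xs = xs} z∈)) }

      y∷⊆ : y ∷ filter P? xs ⊆ filter Q? xs
      y∷⊆ (here refl) = ∈-filter⁺ Q? y∈xs Qy
      y∷⊆ (there z∈)  = let z∈xs , Pz = ∈-filter⁻ P? {xs = xs} z∈ in ∈-filter⁺ Q? z∈xs (P⇒Q Pz)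

∃-unrelated : {R : B → Pred A r} (R? : ∀ b → Decidable (R b)) (c : ℕ) (bs : List B) (H : List A)
            → (∀ {b} → b ∈ bs → length (filter (R? b) H) ≤ c)
            → length bs * c < length H → ∃[ x ] x ∈ H × All (λ b → ¬ R b x) bs
∃-unrelated R? c [] (x ∷ _) _ _ = x , here refl , []
∃-unrelated {R = R} R? c (b ∷ bs) H bound |b∷bs|c<|H| =
  extend (∃-unrelated R? c bs H′ bound′ |bs|c<|H′|)
  where
    H′ = filter (∁? (R? b)) H

    bound′ : ∀ {b′} → b′ ∈ bs → length (filter (R? b′) H′) ≤ c
    bound′ {b′} b′∈bs = ℕP.≤-trans (length-filter-filter≤ (R? b′) (∁? (R? b)) H) (bound (there b′∈bs))

    |bs|c<|H′| : length bs * c < length H′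
    |bs|c<|H′| = ℕP.+-cancelˡ-< c _ _ (begin-strict
      c + length bs * c                    <⟨ |b∷bs|c<|H| ⟩
      length H                             ≤⟨ length≤filter+filter∁ (R? b) H ⟩
      length (filter (R? b) H) + length H′ ≤⟨ ℕP.+-monoˡ-≤ _ (bound (here refl)) ⟩
      c + length H′                        ∎)
      where open ℕP.≤-Reasoning

    extend : ∃[ x ] x ∈ H′ × All (λ b′ → ¬ R b′ x) bs → ∃[ x ] x ∈ H × All (λ b′ → ¬ R b′ x) (b ∷ bs)
    extend (x , x∈H′ , unrelated) =
      let x∈H , ¬Rbx = ∈-filter⁻ (∁? (R? b)) x∈H′ in x , x∈H , ¬Rbx ∷ unrelated

m*[2+2]<8*[1+m] : ∀ m → m * (2 + 2) < 8 * suc m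
m*[2+2]<8*[1+m] m = subst (m * (2 + 2) <_) (eq m) (ℕP.m<m+n _ z<s)
  where
    eq : ∀ m → m * (2 + 2) + suc (m * 4 + 7) ≡ 8 * suc m
    eq = solve-∀

-- 16 * suc m ∸ 1 computes to m + 15 * suc m.
m*[8k+8k]<k*[16k∸1] : ∀ m → let k = suc m in m * (8 * k + 8 * k) < k * (16 * k ∸ 1)
m*[8k+8k]<k*[16k∸1] m = subst (m * (8 * suc m + 8 * suc m) <_) (eq m) (ℕP.m<m+n _ z<s)
  where
    eq : ∀ m → m * (8 * suc m + 8 * suc m) + suc (15 * m + 14) ≡ suc m * (m + 15 * suc m)
    eq = solve-∀

module _ {n : ℕ} (G : WGraph n) where

  _≟ₑ_ : DecidableEquality (Edge n)
  _≟ₑ_ = ≡-dec FinP._≟_ FinP._≟_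

  open import Data.List.Membership.DecPropositional _≟ₑ_ using (_∈?_)

  infix 4 _≺ᴳ_
  _≺ᴳ_ : Edge n → Edge n → Set
  _≺ᴳ_ = _≺_ G

  private
    variable
      e f g : Edge n
      u v : Fin n

    _<ₑ_ : Edge n → Edge n → Set
    _<ₑ_ = ×-Lex _≡_ Fin._<_ Fin._<_

    -- e ≺ᴳ f is definitionally ×-Lex _≡_ ℚ._<_ _<ₑ_ (key e) (key f).
    key : Edge n → ℚ × Edge n
    key e = wt G e , e

  ≺-trans : e ≺ᴳ f → f ≺ᴳ g → e ≺ᴳ g
  ≺-trans {e} {f} {g} =
    ×-transitive {_<₂_ = _<ₑ_} isEquivalence (resp₂ ℚ._<_) ℚP.<-trans
      (×-transitive {_<₂_ = Fin._<_} isEquivalence FinP.<-resp₂-≡ FinP.<-trans FinP.<-trans)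
      {key e} {key f} {key g}

  ≺-irrefl : ¬ e ≺ᴳ e
  ≺-irrefl {e} =
    ×-irreflexive {_≈₁_ = _≡_} {_≈₂_ = Pointwise _≡_ _≡_} {_<₂_ = _<ₑ_} ℚP.<-irrefl
      (×-irreflexive {_≈₁_ = _≡_} {_≈₂_ = _≡_} {_<₂_ = Fin._<_} FinP.<-irrefl FinP.<-irrefl)
      {key e} {key e} (refl , refl , refl)

  ≺-compare : ∀ e f → e ≺ᴳ f ⊎ e ≡ f ⊎ f ≺ᴳ e
  ≺-compare e f with ×-compare sym ℚP.<-cmp (×-compare sym FinP.<-cmp FinP.<-cmp) (key e) (key f)
  ... | tri< e≺f _ _                 = inj₁ e≺f
  ... | tri≈ _ (_ , e₁≡f₁ , e₂≡f₂) _ = inj₂ (inj₁ (×-≡,≡→≡ (e₁≡f₁ , e₂≡f₂)))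
  ... | tri> _ _ f≺e                 = inj₂ (inj₂ f≺e)

  ≺⇒wt≤ : e ≺ᴳ f → wt G e ℚ.≤ wt G f
  ≺⇒wt≤ (inj₁ wt<wt)      = ℚP.<⇒≤ wt<wt
  ≺⇒wt≤ (inj₂ (wt≡wt , _)) = ℚP.≤-reflexive wt≡wt

  rankIn-< : ∀ {L} → Unique L → f ∈ L → e ≺ᴳ f → rankIn G L f < rankIn G L e
  rankIn-< L! f∈L e≺f = length-filter-< (_≺?_ G _) (_≺?_ G _) (≺-trans e≺f) L! f∈L e≺f ≺-irrefl

  rankAt-< : f ∈ edges G → Incident G u f → e ≺ᴳ f → rankAt G u f < rankAt G u e
  rankAt-< {u = u} f∈G u∈f e≺f =
    length-filter-< (λ g → incident? G u g ×-dec _≺?_ G _ g) (λ g → incident? G u g ×-dec _≺?_ G _ g)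
      (map₂ (≺-trans e≺f)) (unique G) f∈G (u∈f , e≺f) (≺-irrefl ∘ proj₂)

  rankAt-injectiveOn : e ∈ edges G × Incident G u e → f ∈ edges G × Incident G u f
                     → rankAt G u e ≡ rankAt G u f → e ≡ f
  rankAt-injectiveOn {e} {f = f} (e∈G , u∈e) (f∈G , u∈f) rank≡ with ≺-compare e f
  ... | inj₁ e≺f        = ⊥-elim (ℕP.<⇒≢ (rankAt-< f∈G u∈f e≺f) (sym rank≡))
  ... | inj₂ (inj₁ e≡f) = e≡f
  ... | inj₂ (inj₂ f≺e) = ⊥-elim (ℕP.<⇒≢ (rankAt-< e∈G u∈e f≺e) rank≡)

  trimmed? : ∀ k → Decidable (InTrimmed G k)
  trimmed? k e = (rankAt G (proj₁ e) e <? 8 * k) ×-dec (rankAt G (proj₂ e) e <? 8 * k)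

  rankAt<8k : ∀ k → Incident G u f → InTrimmed G k f → rankAt G u f < 8 * k
  rankAt<8k k (inj₁ refl) (rank₁<8k , _) = rank₁<8k
  rankAt<8k k (inj₂ refl) (_ , rank₂<8k) = rank₂<8k

  trimmed-degree≤ : ∀ k u → length (filter (incident? G u) (trimmedEdges G k)) ≤ 8 * k
  trimmed-degree≤ k u =
    length≤-injectiveOn (rankAt G u) rankAt-injectiveOn
      (Unique.filter⁺ (incident? G u) (Unique.filter⁺ (trimmed? k) (unique G)))
      (All.map proj₁ facts) (All.map proj₂ facts)
    where
      facts : All (λ f → (f ∈ edges G × Incident G u f) × rankAt G u f < 8 * k)
                  (filter (incident? G u) (trimmedEdges G k))
      facts = All.tabulate λ f∈ →
        let f∈T , u∈f = ∈-filter⁻ (incident? G u) f∈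
            f∈G , f∈Gₜ = ∈-filter⁻ (trimmed? k) f∈T
        in (f∈G , u∈f) , rankAt<8k k u∈f f∈Gₜ

  reduced⊆edges : ∀ k → reducedEdges G k ⊆ edges G
  reduced⊆edges k = proj₁ ∘ ∈-filter⁻ (trimmed? k) ∘ if-filter-⊆ _ _

  ∉reduced⇒heavy : ∀ k → e ∈ trimmedEdges G k → e ∉ reducedEdges G k
                 → k * (16 * k ∸ 1) ≤ rankIn G (trimmedEdges G k) e
  ∉reduced⇒heavy k e∈T e∉R = ℕP.≮⇒≥ (∉-if-filter⇒¬ _ _ e∈T e∉R)

  ¬trimmed⇒heavy-endpoint : ∀ k → ¬ InTrimmed G k e → ∃[ v ] Incident G v e × 8 * k ≤ rankAt G v e
  ¬trimmed⇒heavy-endpoint {e} k e∉Gₜ with rankAt G (proj₁ e) e <? 8 * k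
  ... | yes rank₁<8k = proj₂ e , inj₂ refl , ℕP.≮⇒≥ (λ rank₂<8k → e∉Gₜ (rank₁<8k , rank₂<8k))
  ... | no  rank₁≮8k = proj₁ e , inj₁ refl , ℕP.≮⇒≥ rank₁≮8k

  Meets : Edge n → Pred (Edge n) 0ℓ
  Meets g = Incident G (proj₁ g) ∪ Incident G (proj₂ g)

  meets? : ∀ g → Decidable (Meets g)
  meets? g = incident? G (proj₁ g) ∪? incident? G (proj₂ g)

  ¬Meets⇒Disjoint : ¬ Meets g f → Disjoint G f g
  ¬Meets⇒Disjoint ¬meets =
    ¬meets ∘ inj₁ ∘ inj₁ , ¬meets ∘ inj₂ ∘ inj₁ , ¬meets ∘ inj₁ ∘ inj₂ , ¬meets ∘ inj₂ ∘ inj₂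

  Disjoint-sym : Disjoint G e f → Disjoint G f e
  Disjoint-sym (e₁≢f₁ , e₁≢f₂ , e₂≢f₁ , e₂≢f₂) =
    ≢-sym e₁≢f₁ , ≢-sym e₂≢f₁ , ≢-sym e₁≢f₂ , ≢-sym e₂≢f₂

  Disjoint⇒¬Incident : Disjoint G e g → Incident G v e → ¬ Incident G v g
  Disjoint⇒¬Incident (e₁≢g₁ , _ , _ , _) (inj₁ refl) (inj₁ g₁≡v) = e₁≢g₁ (sym g₁≡v)
  Disjoint⇒¬Incident (_ , e₁≢g₂ , _ , _) (inj₁ refl) (inj₂ g₂≡v) = e₁≢g₂ (sym g₂≡v)
  Disjoint⇒¬Incident (_ , _ , e₂≢g₁ , _) (inj₂ refl) (inj₁ g₁≡v) = e₂≢g₁ (sym g₁≡v)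
  Disjoint⇒¬Incident (_ , _ , _ , e₂≢g₂) (inj₂ refl) (inj₂ g₂≡v) = e₂≢g₂ (sym g₂≡v)

  length-incident-both≤2 : ∀ {H} → u ≢ v → Unique H → All (Incident G v) H
                         → length (filter (incident? G u) H) ≤ 2
  length-incident-both≤2 {u} {v} {H} u≢v H! v∈H =
    Unique⇒length≤ (Unique.filter⁺ (incident? G u) H!) ⊆uv
    where
      ⊆uv : filter (incident? G u) H ⊆ (u , v) ∷ (v , u) ∷ []
      ⊆uv f∈ with f∈H , u∈f ← ∈-filter⁻ (incident? G u) f∈ | u∈f | All.lookup v∈H f∈H
      ... | inj₁ refl | inj₂ refl = here refl
      ... | inj₂ refl | inj₁ refl = there (here refl)
      ... | inj₁ refl | inj₁ refl = ⊥-elim (u≢v refl)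
      ... | inj₂ refl | inj₂ refl = ⊥-elim (u≢v refl)

  Replacement : Edge n → List (Edge n) → Set
  Replacement e rest = ∃[ f ] f ∈ edges G × e ≺ᴳ f × All (Disjoint G f) rest

  replacement-among : ∀ c rest {H} → (∀ {f} → f ∈ H → f ∈ edges G × e ≺ᴳ f)
                    → (∀ {g u} → g ∈ rest → Incident G u g → length (filter (incident? G u) H) ≤ c)
                    → length rest * (c + c) < length H → Replacement e rest
  replacement-among {e} c rest {H} heavier degree≤c |rest|2c<|H| =
    replacement (∃-unrelated meets? (c + c) rest H meets≤2c |rest|2c<|H|)
    where
      meets≤2c : ∀ {g} → g ∈ rest → length (filter (meets? g) H) ≤ c + c
      meets≤2c g∈rest = ℕP.≤-trans (length-filter-∪ (incident? G _) (incident? G _) H)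
        (ℕP.+-mono-≤ (degree≤c g∈rest (inj₁ refl)) (degree≤c g∈rest (inj₂ refl)))

      replacement : ∃[ f ] f ∈ H × All (λ g → ¬ Meets g f) rest → Replacement e rest
      replacement (f , f∈H , f∉rest) =
        let f∈G , e≺f = heavier f∈H in f , f∈G , e≺f , All.map ¬Meets⇒Disjoint f∉rest

  replacement-at-heavy-endpoint : ∀ {rest} → All (Disjoint G e) rest → Incident G v e
                                → 8 * suc (length rest) ≤ rankAt G v e → Replacement e rest
  replacement-at-heavy-endpoint {e} {v} {rest} e⊥rest v∈e heavy =
    replacement-among 2 rest (map₂ proj₂ ∘ heavier-at-v) degree≤2
      (ℕP.<-≤-trans (m*[2+2]<8*[1+m] (length rest)) heavy)
    where
      P? = λ f → incident? G v f ×-dec _≺?_ G e f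
      H = filter P? (edges G)

      heavier-at-v : ∀ {f} → f ∈ H → f ∈ edges G × Incident G v f × e ≺ᴳ f
      heavier-at-v = ∈-filter⁻ P? {xs = edges G}

      degree≤2 : ∀ {g u} → g ∈ rest → Incident G u g → length (filter (incident? G u) H) ≤ 2
      degree≤2 g∈rest u∈g = length-incident-both≤2
        (λ { refl → Disjoint⇒¬Incident (All.lookup e⊥rest g∈rest) v∈e u∈g })
        (Unique.filter⁺ P? (unique G)) (All.tabulate (proj₁ ∘ proj₂ ∘ heavier-at-v))

  replacement-in-trimmed : ∀ {rest} → let k = suc (length rest) in
                           k * (16 * k ∸ 1) ≤ rankIn G (trimmedEdges G k) e → Replacement e rest
  replacement-in-trimmed {e} {rest} heavy =
    replacement-among (8 * k) rest heavier degree≤8k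
      (ℕP.<-≤-trans (m*[8k+8k]<k*[16k∸1] (length rest)) heavy)
    where
      k = suc (length rest)
      T = trimmedEdges G k

      heavier : ∀ {f} → f ∈ filter (_≺?_ G e) T → f ∈ edges G × e ≺ᴳ f
      heavier f∈ =
        let f∈T , e≺f = ∈-filter⁻ (_≺?_ G e) {xs = T} f∈ in proj₁ (∈-filter⁻ (trimmed? k) f∈T) , e≺f

      degree≤8k : ∀ {g u} → g ∈ rest → Incident G u g
                → length (filter (incident? G u) (filter (_≺?_ G e) T)) ≤ 8 * k
      degree≤8k {u = u} _ _ =
        ℕP.≤-trans (length-filter-filter≤ (incident? G u) (_≺?_ G e) T) (trimmed-degree≤ k u)

  replacement : ∀ {k e rest} → IsKMatching G (edges G) k (e ∷ rest) → e ∉ reducedEdges G k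
              → Replacement e rest
  replacement {k} ((e∈G ∷ _) , refl , (e⊥rest ∷ _)) e∉R with trimmed? k _
  ... | yes e∈Gₜ = replacement-in-trimmed (∉reduced⇒heavy k (∈-filter⁺ (trimmed? k) e∈G e∈Gₜ) e∉R)
  ... | no  e∉Gₜ = let v , v∈e , heavy = ¬trimmed⇒heavy-endpoint k e∉Gₜ in
                   replacement-at-heavy-endpoint e⊥rest v∈e heavy

  IsKMatching-resp-↭ : ∀ {L k M M′} → M ↭ M′ → IsKMatching G L k M → IsKMatching G L k M′
  IsKMatching-resp-↭ M↭M′ (M⊆L , |M|≡k , M-disjoint) =
    All-resp-↭ M↭M′ M⊆L ,
    trans (sym (↭-length M↭M′)) |M|≡k ,
    AllPairs-resp-↭ (setoid (Edge n)) Disjoint-sym (resp₂ (Disjoint G)) (↭⇒↭ₛ M↭M′) M-disjoint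

  exchange-head : ∀ {L k rest} → IsKMatching G L k (e ∷ rest) → f ∈ L → All (Disjoint G f) rest
                → IsKMatching G L k (f ∷ rest)
  exchange-head ((_ ∷ rest⊆L) , |e∷rest|≡k , (_ ∷ rest-disjoint)) f∈L f⊥rest =
    (f∈L ∷ rest⊆L) , |e∷rest|≡k , (f⊥rest ∷ rest-disjoint)

  weight-↭ : ∀ {M M′} → M ↭ M′ → weight G M ≡ weight G M′
  weight-↭ M↭M′ =
    foldr-commMonoid (setoid ℚ) ℚP.+-0-isCommutativeMonoid (↭⇒↭ₛ (↭.map⁺ (wt G) M↭M′))

  potential : List (Edge n) → ℕ
  potential M = sum (map (rankIn G (edges G)) M)

  potential-↭ : ∀ {M M′} → M ↭ M′ → potential M ≡ potential M′
  potential-↭ M↭M′ = sum-↭ (↭.map⁺ (rankIn G (edges G)) M↭M′)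

  improve : ∀ {k M} → IsKMatching G (edges G) k M → ¬ All (_∈ reducedEdges G k) M
          → ∃[ M′ ] IsKMatching G (edges G) k M′ × weight G M ℚ.≤ weight G M′ × potential M′ < potential M
  improve {k} {M} M-match M⊈R
    with e , e∈M , e∉R ← find (All.¬All⇒Any¬ (_∈? reducedEdges G k) M M⊈R)
    with rest , M↭e∷rest ← ∈⇒↭∷ e∈M
    with e∷rest-match ← IsKMatching-resp-↭ M↭e∷rest M-match
    with f , f∈G , e≺f , f⊥rest ← replacement e∷rest-match e∉R
    = f ∷ rest , exchange-head e∷rest-match f∈G f⊥rest , heavier , lower
    where
      heavier : weight G M ℚ.≤ weight G (f ∷ rest)
      heavier = begin
        weight G M          ≡⟨ weight-↭ M↭e∷rest ⟩
        weight G (e ∷ rest) ≤⟨ ℚP.+-monoˡ-≤ (weight G rest) (≺⇒wt≤ e≺f) ⟩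
        weight G (f ∷ rest) ∎
        where open ℚP.≤-Reasoning

      lower : potential (f ∷ rest) < potential M
      lower = begin-strict
        potential (f ∷ rest) <⟨ ℕP.+-monoˡ-< (potential rest) (rankIn-< (unique G) f∈G e≺f) ⟩
        potential (e ∷ rest) ≡⟨ potential-↭ M↭e∷rest ⟨
        potential M          ∎
        where open ℕP.≤-Reasoning

  reduce : ∀ {k} M → Acc _<_ (potential M) → IsKMatching G (edges G) k M
         → ∃[ M′ ] IsKMatching G (reducedEdges G k) k M′ × weight G M ℚ.≤ weight G M′
  reduce {k} M (acc smaller) M-match with all? (_∈? reducedEdges G k) M
  ... | yes M⊆R = M , (M⊆R , proj₂ M-match) , ℚP.≤-refl
  ... | no  M⊈R =
    let M′ , M′-match , M≤M′ , M′<M = improve M-match M⊈R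
        M″ , M″-match , M′≤M″ = reduce M′ (smaller M′<M) M′-match
    in M″ , M″-match , ℚP.≤-trans M≤M′ M′≤M″

lemma4p3 : (n : ℕ) (G : WGraph n) (k : ℕ) → 1 ≤ k → (M : List (Edge n))
           → IsMaxKMatching G (reducedEdges G k) k M
           → IsMaxKMatching G (edges G) k M
lemma4p3 n G k _ M ((M⊆R , |M|≡k , M-disjoint) , M-max) =
  (All.map (reduced⊆edges G k) M⊆R , |M|≡k , M-disjoint) , λ M′ M′-match →
    let M″ , M″-match , M′≤M″ = reduce G M′ (<-wellFounded _) M′-match
    in ℚP.≤-trans M′≤M″ (M-max M″ M″-match)
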